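{- Let $P=\langle\mu,\lambda\rangle$ be a finite perfect group with $\mu^2=\lambda^3=1$. Then $P=\langle[\mu,\lambda],[\mu,\lambda^2]\rangle$.
   Context: Commutators are $[a,b]=a^{ -1}b^{ -1}ab$. A group $P$ is perfect if $P=P'$. -}

module Defs where

open import Level using (Level; _⊔_; Lift)
open import Algebra.Bundles using (Group)
open import Data.Nat using (ℕ)
open import Data.Fin using (Fin)
open import Data.Product using (Σ; ∃; ∃-syntax; _×_; _,_)
open import Data.Sum using (_⊎_)

module GroupDefs {c ℓ : Level} (G : Group c ℓ) where
  open Group G

  [_,_] : Carrier → Carrier → Carrier
  [ a , b ] = ((a ⁻¹ ∙ b ⁻¹) ∙ a) ∙ b

  data ⟨_⟩ (S : Carrier → Set (c ⊔ ℓ)) : Carrier → Set (c ⊔ ℓ) where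
    gen  : ∀ {x} → S x → ⟨ S ⟩ x
    one  : ⟨ S ⟩ ε
    mul  : ∀ {x y} → ⟨ S ⟩ x → ⟨ S ⟩ y → ⟨ S ⟩ (x ∙ y)
    inv  : ∀ {x} → ⟨ S ⟩ x → ⟨ S ⟩ (x ⁻¹)
    resp : ∀ {x y} → x ≈ y → ⟨ S ⟩ x → ⟨ S ⟩ y

  GeneratedBy : (Carrier → Set (c ⊔ ℓ)) → Set (c ⊔ ℓ)
  GeneratedBy S = ∀ x → ⟨ S ⟩ x

  pair : Carrier → Carrier → Carrier → Set (c ⊔ ℓ)
  pair a b x = Lift c ((x ≈ a) ⊎ (x ≈ b))

  Commutators : Carrier → Set (c ⊔ ℓ)
  Commutators x = ∃[ a ] ∃[ b ] (x ≈ [ a , b ])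

  Derived : Carrier → Set (c ⊔ ℓ)
  Derived = ⟨ Commutators ⟩

  Perfect : Set (c ⊔ ℓ)
  Perfect = ∀ x → Derived x

  Finite : Set (c ⊔ ℓ)
  Finite = ∃[ n ] Σ (Fin n → Carrier) (λ f → ∀ x → ∃[ i ] (f i ≈ x))

-- Put x = [μ,λ], y = [μ,λ²] and H = ⟨x, y⟩. Conjugation by the involution μ inverts every [μ,h];
-- by [g,hk] = [g,k]·[g,h]^k and λ³ = 1, conjugation by λ sends x ↦ x⁻¹y and y ↦ x⁻¹. Hence H is
-- normal, and since μ and λ commute modulo H, the quotient by H is abelian: P = P′ ⊆ H.

module Submission where

open import Algebra.Bundles using (Group)
import Algebra.Morphism.Construct.Identity as Identity
open import Algebra.Morphism.Structures using (module GroupMorphisms)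
open import Data.Bool.Base using (Bool; true; false; not)
import Data.Bool.Properties as Bool
open import Data.Fin.Base using (Fin)
import Data.Fin.Properties as Fin
open import Data.List.Base using (List; []; _∷_)
open import Data.Nat.Base using (ℕ)
open import Data.Product.Base using (_×_; _,_; proj₁)
open import Data.Product.Properties using (≡-dec)
open import Data.Sum.Base using (inj₁; inj₂)
open import Data.Vec.Base using (Vec; lookup)
open import Level using (lift; suc; _⊔_)
open import Relation.Binary.Definitions using (_Respects_)
import Relation.Binary.PropositionalEquality.Core as ≡
import Relation.Binary.Reflection as Reflection
open import Relation.Nullary.Decidable.Core using (yes; no)

open import Defs

module FreeGroupSolver {c ℓ} (G : Group c ℓ) where
  open Group G
  open import Algebra.Properties.Group G using (⁻¹-involutive; ⁻¹-anti-homo-∙)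
  open import Relation.Binary.Reasoning.Setoid setoid

  infixl 7 _⊗_
  infix 8 _⁻¹ₑ

  data Expr (n : ℕ) : Set where
    var  : Fin n → Expr n
    idₑ  : Expr n
    _⊗_  : Expr n → Expr n → Expr n
    _⁻¹ₑ : Expr n → Expr n

  ⟦_⟧ : ∀ {n} → Expr n → Vec Carrier n → Carrier
  ⟦ var i ⟧  ρ = lookup ρ i
  ⟦ idₑ ⟧    ρ = ε
  ⟦ e ⊗ f ⟧  ρ = ⟦ e ⟧ ρ ∙ ⟦ f ⟧ ρ
  ⟦ e ⁻¹ₑ ⟧  ρ = ⟦ e ⟧ ρ ⁻¹

  Letter : ℕ → Set
  Letter n = Fin n × Bool

  flip : ∀ {n} → Letter n → Letter n
  flip (i , s) = i , not s

  ⟦_⟧ˡ : ∀ {n} → Letter n → Vec Carrier n → Carrier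
  ⟦ i , false ⟧ˡ ρ = lookup ρ i
  ⟦ i , true  ⟧ˡ ρ = lookup ρ i ⁻¹

  ⟦_⟧ʷ : ∀ {n} → List (Letter n) → Vec Carrier n → Carrier
  ⟦ [] ⟧ʷ    ρ = ε
  ⟦ l ∷ w ⟧ʷ ρ = ⟦ l ⟧ˡ ρ ∙ ⟦ w ⟧ʷ ρ

  push : ∀ {n} → Letter n → List (Letter n) → List (Letter n)
  push l []      = l ∷ []
  push l (m ∷ w) with ≡-dec Fin._≟_ Bool._≟_ l (flip m)
  ... | yes _ = w
  ... | no  _ = l ∷ m ∷ w

  pushAll : ∀ {n} → List (Letter n) → List (Letter n) → List (Letter n)
  pushAll []      v = v
  pushAll (l ∷ w) v = push l (pushAll w v)

  invert : ∀ {n} → List (Letter n) → List (Letter n)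
  invert []      = []
  invert (l ∷ w) = pushAll (invert w) (flip l ∷ [])

  normalise : ∀ {n} → Expr n → List (Letter n)
  normalise (var i) = (i , false) ∷ []
  normalise idₑ     = []
  normalise (e ⊗ f) = pushAll (normalise e) (normalise f)
  normalise (e ⁻¹ₑ) = invert (normalise e)

  module _ {n} (ρ : Vec Carrier n) where

    ⟦flip⟧ : ∀ l → ⟦ flip l ⟧ˡ ρ ≈ ⟦ l ⟧ˡ ρ ⁻¹
    ⟦flip⟧ (i , false) = refl
    ⟦flip⟧ (i , true)  = sym (⁻¹-involutive _)

    push-correct : ∀ l w → ⟦ push l w ⟧ʷ ρ ≈ ⟦ l ⟧ˡ ρ ∙ ⟦ w ⟧ʷ ρ
    push-correct l []      = refl
    push-correct l (m ∷ w) with ≡-dec Fin._≟_ Bool._≟_ l (flip m)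
    ... | no  _    = refl
    ... | yes ≡.refl = begin
      ⟦ w ⟧ʷ ρ                              ≈⟨ identityˡ _ ⟨
      ε ∙ ⟦ w ⟧ʷ ρ                          ≈⟨ ∙-congʳ (inverseˡ _) ⟨
      ⟦ m ⟧ˡ ρ ⁻¹ ∙ ⟦ m ⟧ˡ ρ ∙ ⟦ w ⟧ʷ ρ      ≈⟨ ∙-congʳ (∙-congʳ (⟦flip⟧ m)) ⟨
      (⟦ flip m ⟧ˡ ρ ∙ ⟦ m ⟧ˡ ρ) ∙ ⟦ w ⟧ʷ ρ ≈⟨ assoc _ _ _ ⟩
      ⟦ flip m ⟧ˡ ρ ∙ (⟦ m ⟧ˡ ρ ∙ ⟦ w ⟧ʷ ρ) ∎

    pushAll-correct : ∀ w v → ⟦ pushAll w v ⟧ʷ ρ ≈ ⟦ w ⟧ʷ ρ ∙ ⟦ v ⟧ʷ ρ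
    pushAll-correct []      v = sym (identityˡ _)
    pushAll-correct (l ∷ w) v = begin
      ⟦ push l (pushAll w v) ⟧ʷ ρ          ≈⟨ push-correct l (pushAll w v) ⟩
      ⟦ l ⟧ˡ ρ ∙ ⟦ pushAll w v ⟧ʷ ρ        ≈⟨ ∙-congˡ (pushAll-correct w v) ⟩
      ⟦ l ⟧ˡ ρ ∙ (⟦ w ⟧ʷ ρ ∙ ⟦ v ⟧ʷ ρ)     ≈⟨ assoc _ _ _ ⟨
      (⟦ l ⟧ˡ ρ ∙ ⟦ w ⟧ʷ ρ) ∙ ⟦ v ⟧ʷ ρ     ∎

    invert-correct : ∀ w → ⟦ invert w ⟧ʷ ρ ≈ ⟦ w ⟧ʷ ρ ⁻¹
    invert-correct []      = sym (ε⁻¹≈ε)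
      where open import Algebra.Properties.Group G using (ε⁻¹≈ε)
    invert-correct (l ∷ w) = begin
      ⟦ pushAll (invert w) (flip l ∷ []) ⟧ʷ ρ ≈⟨ pushAll-correct (invert w) (flip l ∷ []) ⟩
      ⟦ invert w ⟧ʷ ρ ∙ (⟦ flip l ⟧ˡ ρ ∙ ε)   ≈⟨ ∙-congˡ (identityʳ _) ⟩
      ⟦ invert w ⟧ʷ ρ ∙ ⟦ flip l ⟧ˡ ρ         ≈⟨ ∙-cong (invert-correct w) (⟦flip⟧ l) ⟩
      ⟦ w ⟧ʷ ρ ⁻¹ ∙ ⟦ l ⟧ˡ ρ ⁻¹               ≈⟨ ⁻¹-anti-homo-∙ _ _ ⟨
      (⟦ l ⟧ˡ ρ ∙ ⟦ w ⟧ʷ ρ) ⁻¹                ∎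

    correct : ∀ e → ⟦ normalise e ⟧ʷ ρ ≈ ⟦ e ⟧ ρ
    correct (var i) = identityʳ _
    correct idₑ     = refl
    correct (e ⊗ f) = trans (pushAll-correct (normalise e) (normalise f)) (∙-cong (correct e) (correct f))
    correct (e ⁻¹ₑ) = trans (invert-correct (normalise e)) (⁻¹-cong (correct e))

  -- Words are kept freely reduced, so identities of the free group have syntactically equal
  -- normal forms and solve's premise is refl.
  open Reflection setoid var ⟦_⟧ (λ e → ⟦ normalise e ⟧ʷ) (λ e ρ → correct ρ e) public
    using (solve; _⊜_)

module _ {c₁ ℓ₁ c₂ ℓ₂} {G₁ : Group c₁ ℓ₁} {G₂ : Group c₂ ℓ₂}
  {f : Group.Carrier G₁ → Group.Carrier G₂}
  (hom : GroupMorphisms.IsGroupHomomorphism (Group.rawGroup G₁) (Group.rawGroup G₂) f) where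
  private
    module D₁ = GroupDefs G₁
    module D₂ = GroupDefs G₂
  open GroupMorphisms.IsGroupHomomorphism hom
  open Group G₂ using (sym)

  ⟨⟩-image : ∀ {S T} → (∀ {x} → S x → D₂.⟨ T ⟩ (f x)) →
             ∀ {x} → D₁.⟨ S ⟩ x → D₂.⟨ T ⟩ (f x)
  ⟨⟩-image S⊆ (D₁.gen s)    = S⊆ s
  ⟨⟩-image S⊆ D₁.one        = D₂.resp (sym ε-homo) D₂.one
  ⟨⟩-image S⊆ (D₁.mul p q)  = D₂.resp (sym (homo _ _)) (D₂.mul (⟨⟩-image S⊆ p) (⟨⟩-image S⊆ q))
  ⟨⟩-image S⊆ (D₁.inv p)    = D₂.resp (sym (⁻¹-homo _)) (D₂.inv (⟨⟩-image S⊆ p))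
  ⟨⟩-image S⊆ (D₁.resp e p) = D₂.resp (⟦⟧-cong e) (⟨⟩-image S⊆ p)

module ConjugationAndCommutators {c ℓ} (G : Group c ℓ) where
  open Group G
  open GroupDefs G
  open FreeGroupSolver G
  open import Algebra.Properties.Group G using (ε⁻¹≈ε; ⁻¹-involutive; ⁻¹-anti-homo-∙)
  open GroupMorphisms rawGroup rawGroup using (IsGroupHomomorphism)
  open import Relation.Binary.Reasoning.Setoid setoid

  infixl 7.5 _^_ _^ₑ_

  _^_ : Carrier → Carrier → Carrier
  z ^ g = (g ⁻¹ ∙ z) ∙ g

  private
    _^ₑ_ : ∀ {n} → Expr n → Expr n → Expr n
    z ^ₑ g = (g ⁻¹ₑ ⊗ z) ⊗ g

    [_,_]ₑ : ∀ {n} → Expr n → Expr n → Expr n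
    [ g , h ]ₑ = ((g ⁻¹ₑ ⊗ h ⁻¹ₑ) ⊗ g) ⊗ h

  ^-cong : ∀ {z z′ g g′} → z ≈ z′ → g ≈ g′ → z ^ g ≈ z′ ^ g′
  ^-cong z≈z′ g≈g′ = ∙-cong (∙-cong (⁻¹-cong g≈g′) z≈z′) g≈g′

  ^-identityʳ : ∀ z → z ^ ε ≈ z
  ^-identityʳ = solve 1 (λ z → z ^ₑ idₑ ⊜ z) refl

  ^-∙ : ∀ z g h → z ^ (g ∙ h) ≈ z ^ g ^ h
  ^-∙ = solve 3 (λ z g h → z ^ₑ (g ⊗ h) ⊜ z ^ₑ g ^ₑ h) refl

  ^-isGroupHomomorphism : ∀ g → IsGroupHomomorphism (_^ g)
  ^-isGroupHomomorphism g = record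
    { isMonoidHomomorphism = record
      { isMagmaHomomorphism = record
        { isRelHomomorphism = record { cong = λ z≈z′ → ^-cong z≈z′ refl }
        ; homo = solve 3 (λ g z w → (z ⊗ w) ^ₑ g ⊜ z ^ₑ g ⊗ w ^ₑ g) refl g
        }
      ; ε-homo = solve 1 (λ g → idₑ ^ₑ g ⊜ idₑ) refl g
      }
    ; ⁻¹-homo = solve 2 (λ g z → z ⁻¹ₑ ^ₑ g ⊜ (z ^ₑ g) ⁻¹ₑ) refl g
    }

  [,]-cong : ∀ {g g′ h h′} → g ≈ g′ → h ≈ h′ → [ g , h ] ≈ [ g′ , h′ ]
  [,]-cong g≈g′ h≈h′ = ∙-cong (∙-cong (∙-cong (⁻¹-cong g≈g′) (⁻¹-cong h≈h′)) g≈g′) h≈h′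

  [g,h]⁻¹≈[h,g] : ∀ g h → [ g , h ] ⁻¹ ≈ [ h , g ]
  [g,h]⁻¹≈[h,g] = solve 2 (λ g h → [ g , h ]ₑ ⁻¹ₑ ⊜ [ h , g ]ₑ) refl

  [g,g]≈ε : ∀ g → [ g , g ] ≈ ε
  [g,g]≈ε = solve 1 (λ g → [ g , g ]ₑ ⊜ idₑ) refl

  [g,ε]≈ε : ∀ g → [ g , ε ] ≈ ε
  [g,ε]≈ε = solve 1 (λ g → [ g , idₑ ]ₑ ⊜ idₑ) refl

  [g,h∙k]≈[g,k]∙[g,h]^k : ∀ g h k → [ g , h ∙ k ] ≈ [ g , k ] ∙ [ g , h ] ^ k
  [g,h∙k]≈[g,k]∙[g,h]^k = solve 3 (λ g h k → [ g , h ⊗ k ]ₑ ⊜ [ g , k ]ₑ ⊗ [ g , h ]ₑ ^ₑ k) refl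

  [g,h⁻¹]≈[h,g]^h⁻¹ : ∀ g h → [ g , h ⁻¹ ] ≈ [ h , g ] ^ h ⁻¹
  [g,h⁻¹]≈[h,g]^h⁻¹ = solve 2 (λ g h → [ g , h ⁻¹ₑ ]ₑ ⊜ [ h , g ]ₑ ^ₑ h ⁻¹ₑ) refl

  [g,h]^g⁻¹≈[h,g⁻¹] : ∀ g h → [ g , h ] ^ g ⁻¹ ≈ [ h , g ⁻¹ ]
  [g,h]^g⁻¹≈[h,g⁻¹] = solve 2 (λ g h → [ g , h ]ₑ ^ₑ g ⁻¹ₑ ⊜ [ h , g ⁻¹ₑ ]ₑ) refl

  [g,h]^h≈[g,h]⁻¹∙[g,h∙h] : ∀ g h → [ g , h ] ^ h ≈ [ g , h ] ⁻¹ ∙ [ g , h ∙ h ]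
  [g,h]^h≈[g,h]⁻¹∙[g,h∙h] = solve 2 (λ g h → [ g , h ]ₑ ^ₑ h ⊜ [ g , h ]ₑ ⁻¹ₑ ⊗ [ g , h ⊗ h ]ₑ) refl

  [g,h∙h]^h≈[g,h]⁻¹∙[g,h∙h∙h] : ∀ g h → [ g , h ∙ h ] ^ h ≈ [ g , h ] ⁻¹ ∙ [ g , h ∙ h ∙ h ]
  [g,h∙h]^h≈[g,h]⁻¹∙[g,h∙h∙h] =
    solve 2 (λ g h → [ g , h ⊗ h ]ₑ ^ₑ h ⊜ [ g , h ]ₑ ⁻¹ₑ ⊗ [ g , h ⊗ h ⊗ h ]ₑ) refl

  Pred : Set (suc (c ⊔ ℓ))
  Pred = Carrier → Set (c ⊔ ℓ)

  NormalisedBy : Pred → Carrier → Set (c ⊔ ℓ)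
  NormalisedBy H g = ∀ {z} → H z → H (z ^ g)

  Normaliser : Pred → Carrier → Set (c ⊔ ℓ)
  Normaliser H g = NormalisedBy H g × NormalisedBy H (g ⁻¹)

  Normal : Pred → Set (c ⊔ ℓ)
  Normal H = ∀ g → NormalisedBy H g

  ⟨⟩-normalisedBy : ∀ {S g} → (∀ {s} → S s → ⟨ S ⟩ (s ^ g)) → NormalisedBy ⟨ S ⟩ g
  ⟨⟩-normalisedBy {g = g} = ⟨⟩-image (^-isGroupHomomorphism g)

  module _ {H : Pred} (H-resp : H Respects _≈_) where

    NormalisedBy-resp : ∀ {g g′} → g ≈ g′ → NormalisedBy H g → NormalisedBy H g′
    NormalisedBy-resp g≈g′ Hᵍ⊆H Hz = H-resp (^-cong refl g≈g′) (Hᵍ⊆H Hz)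

    Normaliser-resp : ∀ {g g′} → g ≈ g′ → Normaliser H g → Normaliser H g′
    Normaliser-resp g≈g′ (Hᵍ⊆H , Hᵍ⁻¹⊆H) =
      NormalisedBy-resp g≈g′ Hᵍ⊆H , NormalisedBy-resp (⁻¹-cong g≈g′) Hᵍ⁻¹⊆H

    ⟨⟩⊆Normaliser : ∀ {X} → (∀ {x} → X x → Normaliser H x) → ∀ {g} → ⟨ X ⟩ g → Normaliser H g
    ⟨⟩⊆Normaliser X⊆N (gen x) = X⊆N x
    ⟨⟩⊆Normaliser X⊆N one =
      NormalisedBy-resp refl ε-normalises , NormalisedBy-resp (sym ε⁻¹≈ε) ε-normalises
      where
      ε-normalises : NormalisedBy H ε
      ε-normalises Hz = H-resp (sym (^-identityʳ _)) Hz
    ⟨⟩⊆Normaliser X⊆N (mul {g} {h} p q) =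
      let (Hᵍ⊆H , Hᵍ⁻¹⊆H) = ⟨⟩⊆Normaliser X⊆N p
          (Hʰ⊆H , Hʰ⁻¹⊆H) = ⟨⟩⊆Normaliser X⊆N q
      in (λ Hz → H-resp (sym (^-∙ _ g h)) (Hʰ⊆H (Hᵍ⊆H Hz)))
       , NormalisedBy-resp (sym (⁻¹-anti-homo-∙ g h))
           (λ Hz → H-resp (sym (^-∙ _ (h ⁻¹) (g ⁻¹))) (Hᵍ⁻¹⊆H (Hʰ⁻¹⊆H Hz)))
    ⟨⟩⊆Normaliser X⊆N (inv {g} p) =
      let (Hᵍ⊆H , Hᵍ⁻¹⊆H) = ⟨⟩⊆Normaliser X⊆N p
      in Hᵍ⁻¹⊆H , NormalisedBy-resp (sym (⁻¹-involutive g)) Hᵍ⊆H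
    ⟨⟩⊆Normaliser X⊆N (resp g≈g′ p) = Normaliser-resp g≈g′ (⟨⟩⊆Normaliser X⊆N p)

    normal-if-generators-normalise : ∀ {X} → GeneratedBy X → (∀ {x} → X x → Normaliser H x) → Normal H
    normal-if-generators-normalise generated X⊆N g = proj₁ (⟨⟩⊆Normaliser X⊆N (generated g))

  module _ {S : Pred} (normal : Normal ⟨ S ⟩) where

    [g,⟨X⟩]⊆⟨S⟩ : ∀ {X g} → (∀ {t} → X t → ⟨ S ⟩ [ g , t ]) →
                  ∀ {h} → ⟨ X ⟩ h → ⟨ S ⟩ [ g , h ]
    [g,⟨X⟩]⊆⟨S⟩ [g,X]⊆ (gen t) = [g,X]⊆ t
    [g,⟨X⟩]⊆⟨S⟩ {g = g} [g,X]⊆ one = resp (sym ([g,ε]≈ε g)) one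
    [g,⟨X⟩]⊆⟨S⟩ {g = g} [g,X]⊆ (mul {h} {k} p q) =
      resp (sym ([g,h∙k]≈[g,k]∙[g,h]^k g h k))
        (mul ([g,⟨X⟩]⊆⟨S⟩ [g,X]⊆ q) (normal k ([g,⟨X⟩]⊆⟨S⟩ [g,X]⊆ p)))
    [g,⟨X⟩]⊆⟨S⟩ {g = g} [g,X]⊆ (inv {h} p) =
      resp (sym ([g,h⁻¹]≈[h,g]^h⁻¹ g h))
        (normal (h ⁻¹) (resp ([g,h]⁻¹≈[h,g] g h) (inv ([g,⟨X⟩]⊆⟨S⟩ [g,X]⊆ p))))
    [g,⟨X⟩]⊆⟨S⟩ [g,X]⊆ (resp h≈h′ p) = resp ([,]-cong refl h≈h′) ([g,⟨X⟩]⊆⟨S⟩ [g,X]⊆ p)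

    Derived⊆⟨⟩ : ∀ {X} → GeneratedBy X → (∀ {s t} → X s → X t → ⟨ S ⟩ [ s , t ]) →
                 ∀ {z} → Derived z → ⟨ S ⟩ z
    Derived⊆⟨⟩ {X} generated [X,X]⊆ = ⟨⟩-image (Identity.isGroupHomomorphism rawGroup refl) commutator∈
      where
      [X,G]⊆ : ∀ {s} → X s → ∀ h → ⟨ S ⟩ [ s , h ]
      [X,G]⊆ Xs h = [g,⟨X⟩]⊆⟨S⟩ ([X,X]⊆ Xs) (generated h)

      commutator∈ : ∀ {z} → Commutators z → ⟨ S ⟩ z
      commutator∈ (g , h , z≈[g,h]) = resp (sym z≈[g,h])
        ([g,⟨X⟩]⊆⟨S⟩ (λ {t} Xt → resp ([g,h]⁻¹≈[h,g] t g) (inv ([X,G]⊆ Xt g))) (generated h))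

module InvolutionAndOrderThree {c ℓ} (G : Group c ℓ) {a b : Group.Carrier G}
  (a∙a≈ε : Group._≈_ G (Group._∙_ G a a) (Group.ε G))
  (b∙b∙b≈ε : Group._≈_ G (Group._∙_ G (Group._∙_ G b b) b) (Group.ε G)) where
  open Group G
  open GroupDefs G
  open ConjugationAndCommutators G
  open import Algebra.Properties.Group G using (inverseˡ-unique)
  open import Relation.Binary.Reasoning.Setoid setoid

  H : Pred
  H = ⟨ pair [ a , b ] [ a , b ∙ b ] ⟩

  resp-[,] : ∀ {s t g h} → s ≈ g → t ≈ h → H [ g , h ] → H [ s , t ]
  resp-[,] s≈g t≈h = resp ([,]-cong (sym s≈g) (sym t≈h))

  resp-^ : ∀ {s z g w} → s ≈ z → z ^ g ≈ w → H w → H (s ^ g)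
  resp-^ s≈z zᵍ≈w = resp (sym (trans (^-cong s≈z refl) zᵍ≈w))

  [a,b]∈H : H [ a , b ]
  [a,b]∈H = gen (lift (inj₁ refl))

  [a,b∙b]∈H : H [ a , b ∙ b ]
  [a,b∙b]∈H = gen (lift (inj₂ refl))

  a⁻¹≈a : a ⁻¹ ≈ a
  a⁻¹≈a = sym (inverseˡ-unique a a a∙a≈ε)

  b⁻¹≈b∙b : b ⁻¹ ≈ b ∙ b
  b⁻¹≈b∙b = sym (inverseˡ-unique (b ∙ b) b b∙b∙b≈ε)

  [a,h]^a≈[a,h]⁻¹ : ∀ h → [ a , h ] ^ a ≈ [ a , h ] ⁻¹
  [a,h]^a≈[a,h]⁻¹ h = begin
    [ a , h ] ^ a      ≈⟨ ^-cong refl a⁻¹≈a ⟨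
    [ a , h ] ^ a ⁻¹   ≈⟨ [g,h]^g⁻¹≈[h,g⁻¹] a h ⟩
    [ h , a ⁻¹ ]       ≈⟨ [,]-cong refl a⁻¹≈a ⟩
    [ h , a ]          ≈⟨ [g,h]⁻¹≈[h,g] a h ⟨
    [ a , h ] ⁻¹       ∎

  [a,b∙b]^b≈[a,b]⁻¹ : [ a , b ∙ b ] ^ b ≈ [ a , b ] ⁻¹
  [a,b∙b]^b≈[a,b]⁻¹ = begin
    [ a , b ∙ b ] ^ b                  ≈⟨ [g,h∙h]^h≈[g,h]⁻¹∙[g,h∙h∙h] a b ⟩
    [ a , b ] ⁻¹ ∙ [ a , b ∙ b ∙ b ]   ≈⟨ ∙-congˡ (trans ([,]-cong refl b∙b∙b≈ε) ([g,ε]≈ε a)) ⟩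
    [ a , b ] ⁻¹ ∙ ε                   ≈⟨ identityʳ _ ⟩
    [ a , b ] ⁻¹                       ∎

  a-normalises : Normaliser H a
  a-normalises = a-normalisesH , NormalisedBy-resp resp (sym a⁻¹≈a) a-normalisesH
    where
    a-normalisesH : NormalisedBy H a
    a-normalisesH = ⟨⟩-normalisedBy λ where
      (lift (inj₁ s≈x)) → resp-^ s≈x ([a,h]^a≈[a,h]⁻¹ b) (inv [a,b]∈H)
      (lift (inj₂ s≈y)) → resp-^ s≈y ([a,h]^a≈[a,h]⁻¹ (b ∙ b)) (inv [a,b∙b]∈H)

  b-normalises : Normaliser H b
  b-normalises = b-normalisesH , NormalisedBy-resp resp (sym b⁻¹≈b∙b) b∙b-normalisesH
    where
    b-normalisesH : NormalisedBy H b
    b-normalisesH = ⟨⟩-normalisedBy λ where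
      (lift (inj₁ s≈x)) → resp-^ s≈x ([g,h]^h≈[g,h]⁻¹∙[g,h∙h] a b) (mul (inv [a,b]∈H) [a,b∙b]∈H)
      (lift (inj₂ s≈y)) → resp-^ s≈y [a,b∙b]^b≈[a,b]⁻¹ (inv [a,b]∈H)

    b∙b-normalisesH : NormalisedBy H (b ∙ b)
    b∙b-normalisesH Hz = resp (sym (^-∙ _ b b)) (b-normalisesH (b-normalisesH Hz))

  H-normal : GeneratedBy (pair a b) → Normal H
  H-normal generated = normal-if-generators-normalise resp generated λ where
    (lift (inj₁ g≈a)) → Normaliser-resp resp (sym g≈a) a-normalises
    (lift (inj₂ g≈b)) → Normaliser-resp resp (sym g≈b) b-normalises

  [pair,pair]⊆H : ∀ {s t} → pair a b s → pair a b t → H [ s , t ]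
  [pair,pair]⊆H (lift (inj₁ s≈a)) (lift (inj₁ t≈a)) = resp-[,] s≈a t≈a (resp (sym ([g,g]≈ε a)) one)
  [pair,pair]⊆H (lift (inj₁ s≈a)) (lift (inj₂ t≈b)) = resp-[,] s≈a t≈b [a,b]∈H
  [pair,pair]⊆H (lift (inj₂ s≈b)) (lift (inj₁ t≈a)) = resp-[,] s≈b t≈a (resp ([g,h]⁻¹≈[h,g] a b) (inv [a,b]∈H))
  [pair,pair]⊆H (lift (inj₂ s≈b)) (lift (inj₂ t≈b)) = resp-[,] s≈b t≈b (resp (sym ([g,g]≈ε b)) one)

open Group using (Carrier; _∙_; _≈_; ε)
open GroupDefs using (Finite; Perfect; GeneratedBy; pair; [_,_])

mainTheorem5 : ∀ {c ℓ} (P : Group c ℓ) (μ λ′ : Carrier P) →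
    Finite P →
    Perfect P →
    GeneratedBy P (pair P μ λ′) →
    _≈_ P (_∙_ P μ μ) (ε P) →
    _≈_ P (_∙_ P (_∙_ P λ′ λ′) λ′) (ε P) →
    GeneratedBy P (pair P ([_,_] P μ λ′) ([_,_] P μ (_∙_ P λ′ λ′)))
mainTheorem5 P μ λ′ _ perfect generated μ∙μ≈ε λ′∙λ′∙λ′≈ε z =
  Derived⊆⟨⟩ (H-normal generated) generated [pair,pair]⊆H (perfect z)
  where
  open ConjugationAndCommutators P using (Derived⊆⟨⟩)
  open InvolutionAndOrderThree P μ∙μ≈ε λ′∙λ′∙λ′≈ε
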